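{- Let $x\in\mathbb{C}$ and let $\sqrt{9x^2-1}$ denote a fixed complex square root of $9x^2-1$. Then for every integer $n\geq 0$, $$\sum_{k=0}^n \binom{n}{k}\bigl(12x\sqrt{9x^2-1}\bigr)^{n-k} B^*_{2k}(x)\,B_{n-k}(x) = 6nx\bigl(18x^2-1+6x(2x-1)\sqrt{9x^2-1}\bigr)^{n-1}.$$
   Context: The Bernoulli polynomials $B_n(x)$ are defined by $\sum_{n\ge0}B_n(x)\frac{z^n}{n!}=\frac{ze^{xz}}{e^z-1}$ ($|z|<2\pi$). The balancing polynomials are defined by $B^*_0(x)=0$, $B^*_1(x)=1$, $B^*_n(x)=6xB^*_{n-1}(x)-B^*_{n-2}(x)$ for $n\ge2$. For $n=0$ the right-hand side, which carries the factor $n$, is interpreted as $0$. -}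

module Defs where

open import Data.Nat using (ℕ; zero; suc; _∸_; _<ᵇ_)
open import Data.Nat.Combinatorics using (_C_)
open import Data.Integer using (+_)
open import Data.Rational using (ℚ; _/_)
open import Data.Product using (_×_; _,_; proj₁)
open import Data.Bool using (if_then_else_)
open import Algebra.Bundles using (CommutativeRing)

-- Everything is developed over a commutative ring R together with a map
-- ι : ℚ → R (in the statement ι is required to be a ring homomorphism,
-- i.e. R is a ℚ-algebra; ℂ is the case of interest).
module Over {c ℓ} (R : CommutativeRing c ℓ) (ι : ℚ → CommutativeRing.Carrier R) where
  open CommutativeRing R

  nat : ℕ → Carrier
  nat k = ι (+ k / 1)

  pow : Carrier → ℕ → Carrier
  pow x zero    = 1#
  pow x (suc n) = x * pow x n

  sumTo : ℕ → (ℕ → Carrier) → Carrier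
  sumTo zero    f = f 0
  sumTo (suc n) f = sumTo n f + f (suc n)

  sumBelow : ℕ → (ℕ → Carrier) → Carrier
  sumBelow zero    f = 0#
  sumBelow (suc n) f = sumBelow n f + f n

  -- Comparing coefficients of z^(m+1)/(m+1)! in
  -- (e^z - 1) * Σ B_n(x) z^n/n! = z e^(xz) gives
  --   Σ_{k=0}^{m} C(m+1,k) B_k(x) = (m+1) x^m,
  -- i.e.  B_m(x) = x^m - (1/(m+1)) Σ_{k<m} C(m+1,k) B_k(x).
  nextB : Carrier → ℕ → (ℕ → Carrier) → Carrier
  nextB x m b = pow x m - ι (+ 1 / suc m) * sumBelow m (λ k → nat (suc m C k) * b k)

  -- bernTable x m k = B_k(x) for k < m
  bernTable : Carrier → ℕ → ℕ → Carrier
  bernTable x zero    k = 0#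
  bernTable x (suc m) k = if k <ᵇ m then bernTable x m k else nextB x m (bernTable x m)

  bernoulli : ℕ → Carrier → Carrier
  bernoulli n x = nextB x n (bernTable x n)

  -- (B*_n(x), B*_{n+1}(x))
  balPair : ℕ → Carrier → Carrier × Carrier
  balPair zero    x = 0# , 1#
  balPair (suc n) x with balPair n x
  ... | a , b = b , nat 6 * x * b - a

  balancing : ℕ → Carrier → Carrier
  balancing n x = proj₁ (balPair n x)

{-# OPTIONS --safe #-}
-- Put t = 12xs and b = 18x² - 1 - 6xs.  Then t + b and b are the roots of z² - (36x² - 2)z + 1,
-- the characteristic polynomial of k ↦ B*_{2k}(x), so B*_{2k}(x) = 6x U_k with
-- U_k = ((t + b)^k - b^k)/t = Σ_{m<k} C(k,m) t^(k-1-m) b^m.  Substituting this expansion and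
-- exchanging the order of summation, every inner sum Σ_{j<N} C(N,j) B_j(x) is N x^(N-1) by the
-- recurrence defining the Bernoulli polynomials, and what remains, Σ_m C(n,m) (n-m) (tx)^(n-1-m) b^m,
-- is n (tx + b)^(n-1); finally tx + b = 18x² - 1 + 6x(2x - 1)s.
module Submission where

open import Defs
open import Data.Nat using (ℕ; zero; suc; _∸_; _≤_; _<_; s≤s)
open import Data.Nat as ℕ using ()
open import Data.Nat.Properties as ℕ using ()
open import Data.Nat.Combinatorics using (_C_; nCk≡nC[n∸k]; nCn≡1; nC1≡n; nCk+nC[k+1]≡[n+1]C[k+1])
open import Data.Integer using (+_)
import Data.Integer.Properties as ℤ
open import Data.Rational as ℚ using (ℚ; 1ℚ; mkℚ; _/_)
open import Data.Rational.Properties using (+-*-commutativeRing; normalize-coprime; /-cong; *-inverseʳ)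
import Data.Rational.Properties as ℚ
open import Data.Nat.Coprimality using (1-coprimeTo)
import Data.Nat.Coprimality as Coprime
open import Data.Bool using (true; false)
open import Data.Maybe using (just; nothing)
open import Relation.Nullary using (yes; no)
open import Relation.Nullary.Reflects using (ofʸ; ofⁿ)
import Relation.Binary.PropositionalEquality as ≡
open import Relation.Binary.PropositionalEquality using (_≡_)
open import Relation.Binary.Definitions using (WeaklyDecidable)
open import Algebra.Bundles using (CommutativeRing)
open import Algebra.Morphism.Structures using (IsRingHomomorphism)
import Algebra.Solver.Ring.AlmostCommutativeRing as ACR

module BinomialCoefficients where
  open import Data.Nat
  open import Data.Nat.Properties
  open import Data.Nat.Combinatorics using (_C_; nCk≡n!/k![n-k]!; k![n∸k]!∣n!)
  open import Data.Nat.DivMod using (m/n*n≡m)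
  open import Data.Nat.Tactic.RingSolver using (solve-∀)
  open import Relation.Binary.PropositionalEquality
  open ≡-Reasoning
  open import Algebra.Properties.CommutativeSemigroup *-commutativeSemigroup using (x∙yz≈y∙xz)

  nCk*k![n∸k]!≡n! : ∀ {n k} → k ≤ n → (n C k) * (k ! * (n ∸ k) !) ≡ n !
  nCk*k![n∸k]!≡n! {n} {k} k≤n = trans (cong (_* (k ! * (n ∸ k) !)) (nCk≡n!/k![n-k]! k≤n))
    (m/n*n≡m {{k !* (n ∸ k) !≢0}} (k![n∸k]!∣n! k≤n))

  [1+n]Ck*[1+n∸k]≡[1+n]*nCk : ∀ {n k} → k ≤ n → (suc n C k) * (suc n ∸ k) ≡ suc n * (n C k)
  [1+n]Ck*[1+n∸k]≡[1+n]*nCk {n} {k} k≤n = *-cancelʳ-≡ _ _ (k ! * (n ∸ k) !) {{k !* (n ∸ k) !≢0}} (begin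
    (suc n C k) * (suc n ∸ k) * (k ! * (n ∸ k) !)   ≡⟨ cong (λ i → (suc n C k) * i * (k ! * (n ∸ k) !)) 1+n∸k≡1+[n∸k] ⟩
    (suc n C k) * suc (n ∸ k) * (k ! * (n ∸ k) !)   ≡⟨ regroup (suc n C k) (n ∸ k) (k !) ((n ∸ k) !) ⟩
    (suc n C k) * (k ! * suc (n ∸ k) !)             ≡⟨ cong (λ i → (suc n C k) * (k ! * i !)) 1+n∸k≡1+[n∸k] ⟨
    (suc n C k) * (k ! * (suc n ∸ k) !)             ≡⟨ nCk*k![n∸k]!≡n! (m≤n⇒m≤1+n k≤n) ⟩
    suc n !                                         ≡⟨ cong (suc n *_) (nCk*k![n∸k]!≡n! k≤n) ⟨
    suc n * ((n C k) * (k ! * (n ∸ k) !))           ≡⟨ *-assoc (suc n) (n C k) _ ⟨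
    suc n * (n C k) * (k ! * (n ∸ k) !)             ∎)
    where
    1+n∸k≡1+[n∸k] : suc n ∸ k ≡ suc (n ∸ k)
    1+n∸k≡1+[n∸k] = +-∸-assoc 1 k≤n
    regroup : ∀ a m b f → a * suc m * (b * f) ≡ a * (b * (f + m * f))
    regroup = solve-∀

  nCj*[n∸j]Cm*j!m![n∸j∸m]!≡n! : ∀ {n j m} → j + m ≤ n →
    (n C j) * ((n ∸ j) C m) * (j ! * (m ! * (n ∸ j ∸ m) !)) ≡ n !
  nCj*[n∸j]Cm*j!m![n∸j∸m]!≡n! {n} {j} {m} j+m≤n = begin
    (n C j) * ((n ∸ j) C m) * (j ! * (m ! * (n ∸ j ∸ m) !))   ≡⟨ regroup (n C j) ((n ∸ j) C m) (j !) _ ⟩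
    (n C j) * (j ! * (((n ∸ j) C m) * (m ! * (n ∸ j ∸ m) !))) ≡⟨ cong (λ i → (n C j) * (j ! * i)) (nCk*k![n∸k]!≡n! m≤n∸j) ⟩
    (n C j) * (j ! * (n ∸ j) !)                               ≡⟨ nCk*k![n∸k]!≡n! (≤-trans (m≤m+n j m) j+m≤n) ⟩
    n !                                                       ∎
    where
    m≤n∸j : m ≤ n ∸ j
    m≤n∸j = subst (_≤ n ∸ j) (m+n∸m≡n j m) (∸-monoˡ-≤ j j+m≤n)
    regroup : ∀ a b c d → a * b * (c * d) ≡ a * (c * (b * d))
    regroup = solve-∀

  nCj*[n∸j]Cm≡nCm*[n∸m]Cj : ∀ {n j m} → j + m ≤ n → (n C j) * ((n ∸ j) C m) ≡ (n C m) * ((n ∸ m) C j)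
  nCj*[n∸j]Cm≡nCm*[n∸m]Cj {n} {j} {m} j+m≤n = *-cancelʳ-≡ _ _ (j ! * (m ! * (n ∸ j ∸ m) !)) {{denominator≢0}} (begin
    (n C j) * ((n ∸ j) C m) * (j ! * (m ! * (n ∸ j ∸ m) !)) ≡⟨ nCj*[n∸j]Cm*j!m![n∸j∸m]!≡n! {n} {j} {m} j+m≤n ⟩
    n !                                                     ≡⟨ nCj*[n∸j]Cm*j!m![n∸j∸m]!≡n! {n} {m} {j} (subst (_≤ n) (+-comm j m) j+m≤n) ⟨
    (n C m) * ((n ∸ m) C j) * (m ! * (j ! * (n ∸ m ∸ j) !)) ≡⟨ cong ((n C m) * ((n ∸ m) C j) *_) (denominator-sym) ⟩
    (n C m) * ((n ∸ m) C j) * (j ! * (m ! * (n ∸ j ∸ m) !)) ∎)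
    where
    denominator≢0 : NonZero (j ! * (m ! * (n ∸ j ∸ m) !))
    denominator≢0 = m*n≢0 _ _ {{j !≢0}} {{m !* (n ∸ j ∸ m) !≢0}}
    denominator-sym : m ! * (j ! * (n ∸ m ∸ j) !) ≡ j ! * (m ! * (n ∸ j ∸ m) !)
    denominator-sym rewrite ∸-+-assoc n m j | ∸-+-assoc n j m | +-comm m j = x∙yz≈y∙xz (m !) (j !) _

open BinomialCoefficients

n/1≡mkℚ : ∀ n → + n / 1 ≡ mkℚ (+ n) 0 (Coprime.sym (1-coprimeTo n))
n/1≡mkℚ n = normalize-coprime (Coprime.sym (1-coprimeTo n))

[m+n]/1≡m/1+n/1 : ∀ m n → + (m ℕ.+ n) / 1 ≡ (+ m / 1) ℚ.+ (+ n / 1)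
[m+n]/1≡m/1+n/1 m n rewrite n/1≡mkℚ m | n/1≡mkℚ n =
  /-cong (≡.trans (ℤ.pos-+ m n) (≡.sym (≡.cong₂ Data.Integer._+_ (ℤ.*-identityʳ (+ m)) (ℤ.*-identityʳ (+ n))))) ≡.refl

[m*n]/1≡m/1*n/1 : ∀ m n → + (m ℕ.* n) / 1 ≡ (+ m / 1) ℚ.* (+ n / 1)
[m*n]/1≡m/1*n/1 m n rewrite n/1≡mkℚ m | n/1≡mkℚ n = /-cong (ℤ.pos-* m n) ≡.refl

[1+n]/1*1/[1+n]≡1 : ∀ n → (+ suc n / 1) ℚ.* (+ 1 / suc n) ≡ 1ℚ
[1+n]/1*1/[1+n]≡1 n rewrite n/1≡mkℚ (suc n) | normalize-coprime {1} {n} (1-coprimeTo (suc n)) =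
  *-inverseʳ (mkℚ (+ suc n) 0 (Coprime.sym (1-coprimeTo (suc n))))

module ℚ-Algebra {c ℓ} (R : CommutativeRing c ℓ) (ι : ℚ → CommutativeRing.Carrier R)
  (hom : IsRingHomomorphism (CommutativeRing.rawRing +-*-commutativeRing) (CommutativeRing.rawRing R) ι) where
  open CommutativeRing R
  open Over R ι
  open import Relation.Binary.Reasoning.Setoid setoid
  private module Hom = IsRingHomomorphism hom
  open import Algebra.Properties.Ring ring using (-0#≈0#)

  ι-morphism : CommutativeRing.rawRing +-*-commutativeRing ACR.-Raw-AlmostCommutative⟶ ACR.fromCommutativeRing R
  ι-morphism = record
    { ⟦_⟧ = ι ; +-homo = Hom.+-homo ; *-homo = Hom.*-homo ; -‿homo = Hom.-‿homo ; 0-homo = Hom.0#-homo ; 1-homo = Hom.1#-homo }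

  ι-≟ : WeaklyDecidable (ACR.Induced-equivalence ι-morphism)
  ι-≟ p q with p ℚ.≟ q
  ... | yes ≡.refl = just refl
  ... | no _       = nothing

  -- A ring solver with rational coefficients: `con (+ k / 1)` denotes `nat k` on the nose, but 0# and 1#
  -- are not constants of the solver and must first be rewritten to `nat 0` and `nat 1`.
  open import Algebra.Solver.Ring (CommutativeRing.rawRing +-*-commutativeRing) (ACR.fromCommutativeRing R) ι-morphism ι-≟
    public using (solve; _:=_; con; _:+_; _:*_; _:-_)

  nat-+ : ∀ m n → nat (m ℕ.+ n) ≈ nat m + nat n
  nat-+ m n = trans (reflexive (≡.cong ι ([m+n]/1≡m/1+n/1 m n))) (Hom.+-homo _ _)

  nat-* : ∀ m n → nat (m ℕ.* n) ≈ nat m * nat n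
  nat-* m n = trans (reflexive (≡.cong ι ([m*n]/1≡m/1*n/1 m n))) (Hom.*-homo _ _)

  nat-0 : nat 0 ≈ 0#
  nat-0 = Hom.0#-homo

  nat-1 : nat 1 ≈ 1#
  nat-1 = Hom.1#-homo

  nat-≡ : ∀ {m n} → m ≡ n → nat m ≈ nat n
  nat-≡ e = reflexive (≡.cong nat e)

  nat-*-inverse : ∀ n → nat (suc n) * ι (+ 1 / suc n) ≈ 1#
  nat-*-inverse n = trans (sym (Hom.*-homo _ _)) (trans (reflexive (≡.cong ι ([1+n]/1*1/[1+n]≡1 n))) Hom.1#-homo)

  pow-cong : ∀ {y z} n → y ≈ z → pow y n ≈ pow z n
  pow-cong zero    y≈z = refl
  pow-cong (suc n) y≈z = *-cong y≈z (pow-cong n y≈z)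

  pow-≡ : ∀ y {m n} → m ≡ n → pow y m ≈ pow y n
  pow-≡ y e = reflexive (≡.cong (pow y) e)

  pow-+ : ∀ y m n → pow y (m ℕ.+ n) ≈ pow y m * pow y n
  pow-+ y zero    n = sym (*-identityˡ _)
  pow-+ y (suc m) n = trans (*-congˡ (pow-+ y m n)) (sym (*-assoc _ _ _))

  pow-* : ∀ y z n → pow (y * z) n ≈ pow y n * pow z n
  pow-* y z zero    = sym (*-identityˡ _)
  pow-* y z (suc n) = trans (*-congˡ (pow-* y z n))
    (solve 4 (λ y z p q → (y :* z) :* (p :* q) := (y :* p) :* (z :* q)) refl y z (pow y n) (pow z n))

  sumBelow-cong : ∀ n {f g : ℕ → Carrier} → (∀ k → k < n → f k ≈ g k) → sumBelow n f ≈ sumBelow n g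
  sumBelow-cong zero    f≈g = refl
  sumBelow-cong (suc n) f≈g = +-cong (sumBelow-cong n (λ k k<n → f≈g k (ℕ.m<n⇒m<1+n k<n))) (f≈g n ℕ.≤-refl)

  sumBelow-≡ : ∀ {m n} (f : ℕ → Carrier) → m ≡ n → sumBelow m f ≈ sumBelow n f
  sumBelow-≡ f e = reflexive (≡.cong (λ n → sumBelow n f) e)

  sumBelow-+ : ∀ n (f g : ℕ → Carrier) → sumBelow n (λ k → f k + g k) ≈ sumBelow n f + sumBelow n g
  sumBelow-+ zero    f g = sym (+-identityˡ 0#)
  sumBelow-+ (suc n) f g = trans (+-congʳ (sumBelow-+ n f g))
    (solve 4 (λ a b c d → (a :+ b) :+ (c :+ d) := (a :+ c) :+ (b :+ d)) refl _ _ _ _)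

  sumBelow-*ˡ : ∀ n a (f : ℕ → Carrier) → sumBelow n (λ k → a * f k) ≈ a * sumBelow n f
  sumBelow-*ˡ zero    a f = sym (zeroʳ a)
  sumBelow-*ˡ (suc n) a f = trans (+-congʳ (sumBelow-*ˡ n a f)) (sym (distribˡ a _ _))

  sumBelow-*ʳ : ∀ n a (f : ℕ → Carrier) → sumBelow n (λ k → f k * a) ≈ sumBelow n f * a
  sumBelow-*ʳ zero    a f = sym (zeroˡ a)
  sumBelow-*ʳ (suc n) a f = trans (+-congʳ (sumBelow-*ʳ n a f)) (sym (distribʳ a _ _))

  sumBelow-suc-shift : ∀ n (f : ℕ → Carrier) → sumBelow (suc n) f ≈ f 0 + sumBelow n (λ k → f (suc k))
  sumBelow-suc-shift zero    f = trans (+-identityˡ _) (sym (+-identityʳ _))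
  sumBelow-suc-shift (suc n) f = trans (+-congʳ (sumBelow-suc-shift n f)) (+-assoc _ _ _)

  sumBelow-reverse : ∀ n (f : ℕ → Carrier) → sumBelow n f ≈ sumBelow n (λ k → f (n ∸ suc k))
  sumBelow-reverse zero    f = refl
  sumBelow-reverse (suc n) f = begin
    sumBelow n f + f n                            ≈⟨ +-congʳ (sumBelow-reverse n f) ⟩
    sumBelow n (λ k → f (n ∸ suc k)) + f n        ≈⟨ +-comm _ _ ⟩
    f n + sumBelow n (λ k → f (n ∸ suc k))        ≈⟨ sumBelow-suc-shift n (λ k → f (n ∸ k)) ⟨
    sumBelow (suc n) (λ k → f (suc n ∸ suc k))    ∎

  sumTo≈sumBelow : ∀ n (f : ℕ → Carrier) → sumTo n f ≈ sumBelow (suc n) f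
  sumTo≈sumBelow zero    f = sym (+-identityˡ _)
  sumTo≈sumBelow (suc n) f = +-congʳ (sumTo≈sumBelow n f)

  sumBelow-triangle-suc : ∀ n (g : ℕ → ℕ → Carrier) →
    sumBelow (suc n) (λ j → sumBelow (suc n ∸ j) (g j))
      ≈ sumBelow n (λ j → sumBelow (n ∸ j) (g j)) + sumBelow (suc n) (λ j → g j (n ∸ j))
  sumBelow-triangle-suc n g = begin
    sumBelow (suc n) (λ j → sumBelow (suc n ∸ j) (g j))
      ≈⟨ sumBelow-cong (suc n) (λ j j≤n → sumBelow-≡ (g j) (ℕ.+-∸-assoc 1 (ℕ.≤-pred j≤n))) ⟩
    sumBelow (suc n) (λ j → sumBelow (n ∸ j) (g j) + g j (n ∸ j))
      ≈⟨ sumBelow-+ (suc n) _ _ ⟩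
    (sumBelow n (λ j → sumBelow (n ∸ j) (g j)) + sumBelow (n ∸ n) (g n)) + sumBelow (suc n) (λ j → g j (n ∸ j))
      ≈⟨ +-congʳ (trans (+-congˡ (sumBelow-≡ (g n) (ℕ.n∸n≡0 n))) (+-identityʳ _)) ⟩
    sumBelow n (λ j → sumBelow (n ∸ j) (g j)) + sumBelow (suc n) (λ j → g j (n ∸ j)) ∎

  sumBelow-triangle-swap : ∀ n (g : ℕ → ℕ → Carrier) →
    sumBelow n (λ j → sumBelow (n ∸ j) (g j)) ≈ sumBelow n (λ m → sumBelow (n ∸ m) (λ j → g j m))
  sumBelow-triangle-swap zero    g = refl
  sumBelow-triangle-swap (suc n) g = begin
    sumBelow (suc n) (λ j → sumBelow (suc n ∸ j) (g j))
      ≈⟨ sumBelow-triangle-suc n g ⟩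
    sumBelow n (λ j → sumBelow (n ∸ j) (g j)) + sumBelow (suc n) (λ j → g j (n ∸ j))
      ≈⟨ +-cong (sumBelow-triangle-swap n g) (trans (sumBelow-reverse (suc n) _)
           (sumBelow-cong (suc n) (λ k k≤n → reflexive (≡.cong (g (n ∸ k)) (ℕ.m∸[m∸n]≡n (ℕ.≤-pred k≤n)))))) ⟩
    sumBelow n (λ m → sumBelow (n ∸ m) (λ j → g j m)) + sumBelow (suc n) (λ m → g (n ∸ m) m)
      ≈⟨ sumBelow-triangle-suc n (λ m j → g j m) ⟨
    sumBelow (suc n) (λ m → sumBelow (suc n ∸ m) (λ j → g j m)) ∎

  bernTable-lookup : ∀ x {m k} → k < m → bernTable x m k ≡ bernoulli k x
  bernTable-lookup x {suc m} {k} (s≤s k≤m) with k ℕ.<ᵇ m | ℕ.<ᵇ-reflects-< k m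
  ... | true  | ofʸ k<m = bernTable-lookup x k<m
  ... | false | ofⁿ k≮m = ≡.cong (λ i → bernoulli i x) (≡.sym (ℕ.≤-antisym k≤m (ℕ.≮⇒≥ k≮m)))

  -- The definition of B_m solves this equation for its last term, whose coefficient is C(m+1,m) = m+1.
  bernoulli-recurrence : ∀ x m → sumBelow (suc m) (λ k → nat (suc m C k) * bernoulli k x) ≈ nat (suc m) * pow x m
  bernoulli-recurrence x m = begin
    sumBelow m (λ k → nat (suc m C k) * bernoulli k x) + nat (suc m C m) * bernoulli m x
      ≈⟨ +-cong (sumBelow-cong m (λ k k<m → *-congˡ (reflexive (≡.sym (bernTable-lookup x k<m)))))
                (*-congʳ (nat-≡ [1+m]Cm≡1+m)) ⟩
    earlier + nat (suc m) * (pow x m - inverse * earlier)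
      ≈⟨ solve 4 (λ e n p i → e :+ n :* (p :- i :* e) := n :* p :+ (e :- e :* (n :* i))) refl earlier (nat (suc m)) (pow x m) inverse ⟩
    nat (suc m) * pow x m + (earlier - earlier * (nat (suc m) * inverse))
      ≈⟨ +-congˡ (trans (+-congˡ (-‿cong (trans (*-congˡ (nat-*-inverse m)) (*-identityʳ earlier)))) (-‿inverseʳ earlier)) ⟩
    nat (suc m) * pow x m + 0#
      ≈⟨ +-identityʳ _ ⟩
    nat (suc m) * pow x m ∎
    where
    earlier inverse : Carrier
    earlier = sumBelow m (λ k → nat (suc m C k) * bernTable x m k)
    inverse = ι (+ 1 / suc m)
    [1+m]Cm≡1+m : suc m C m ≡ suc m
    [1+m]Cm≡1+m = ≡.trans (nCk≡nC[n∸k] (ℕ.n≤1+n m)) (≡.trans (≡.cong (suc m C_) (ℕ.m+n∸n≡m 1 m)) (nC1≡n (suc m)))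

  binomialSum : Carrier → Carrier → ℕ → Carrier
  binomialSum u v k = sumBelow (suc k) (λ m → nat (k C m) * pow u (k ∸ m) * pow v m)

  -- The Lucas sequence U_k(t + b, b) = ((t + b)^k - b^k) / t, written without division.
  lucas : Carrier → Carrier → ℕ → Carrier
  lucas t b k = sumBelow k (λ m → nat (k C m) * pow t (k ∸ suc m) * pow b m)

  binomialSum≈t*lucas+pow : ∀ t b k → binomialSum t b k ≈ t * lucas t b k + pow b k
  binomialSum≈t*lucas+pow t b k = +-cong factor-t last-term
    where
    factor-t : sumBelow k (λ m → nat (k C m) * pow t (k ∸ m) * pow b m) ≈ t * lucas t b k
    factor-t = trans (sumBelow-cong k (λ m m<k → trans (*-congʳ (*-congˡ (pow-≡ t (ℕ.+-∸-assoc 1 m<k))))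
                 (solve 4 (λ c t p q → c :* (t :* p) :* q := t :* (c :* p :* q)) refl _ t _ _)))
               (sumBelow-*ˡ k t _)
    last-term : nat (k C k) * pow t (k ∸ k) * pow b k ≈ pow b k
    last-term = trans (*-congʳ (*-cong (trans (nat-≡ (nCn≡1 k)) nat-1) (pow-≡ t (ℕ.n∸n≡0 k))))
                  (trans (*-congʳ (*-identityˡ 1#)) (*-identityˡ _))

  lucas-suc : ∀ t b k → lucas t b (suc k) ≈ b * lucas t b k + binomialSum t b k
  lucas-suc t b k = begin
    lucas t b (suc k)
      ≈⟨ sumBelow-suc-shift k _ ⟩
    first + sumBelow k (λ m → nat (suc k C suc m) * pow t (k ∸ suc m) * pow b (suc m))
      ≈⟨ +-congˡ (sumBelow-cong k (λ m _ → pascal m)) ⟩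
    first + sumBelow k (λ m → b * (nat (k C m) * pow t (k ∸ suc m) * pow b m) + nat (k C suc m) * pow t (k ∸ suc m) * pow b (suc m))
      ≈⟨ +-congˡ (trans (sumBelow-+ k _ _) (+-congʳ (sumBelow-*ˡ k b _))) ⟩
    first + (b * lucas t b k + sumBelow k (λ m → nat (k C suc m) * pow t (k ∸ suc m) * pow b (suc m)))
      ≈⟨ solve 3 (λ a p q → a :+ (p :+ q) := p :+ (a :+ q)) refl _ _ _ ⟩
    b * lucas t b k + (first + sumBelow k (λ m → nat (k C suc m) * pow t (k ∸ suc m) * pow b (suc m)))
      ≈⟨ +-congˡ (sumBelow-suc-shift k _) ⟨
    b * lucas t b k + binomialSum t b k ∎
    where
    first : Carrier
    first = nat (suc k C 0) * pow t k * pow b 0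
    pascal : ∀ m → nat (suc k C suc m) * pow t (k ∸ suc m) * pow b (suc m)
                    ≈ b * (nat (k C m) * pow t (k ∸ suc m) * pow b m) + nat (k C suc m) * pow t (k ∸ suc m) * pow b (suc m)
    pascal m = trans (*-congʳ (*-congʳ (trans (nat-≡ (≡.sym (nCk+nC[k+1]≡[n+1]C[k+1] k m))) (nat-+ (k C m) (k C suc m)))))
      (solve 5 (λ c c' p b q → (c :+ c') :* p :* (b :* q) := b :* (c :* p :* q) :+ c' :* p :* (b :* q)) refl _ _ _ b _)

  binomial-theorem : ∀ u v k → binomialSum u v k ≈ pow (u + v) k
  binomial-theorem u v zero = trans (+-identityˡ _) (trans (*-congʳ (*-congʳ nat-1)) (trans (*-congʳ (*-identityˡ 1#)) (*-identityˡ 1#)))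
  binomial-theorem u v (suc k) = begin
    binomialSum u v (suc k)                                       ≈⟨ binomialSum≈t*lucas+pow u v (suc k) ⟩
    u * lucas u v (suc k) + v * pow v k                           ≈⟨ +-congʳ (*-congˡ (lucas-suc u v k)) ⟩
    u * (v * lucas u v k + binomialSum u v k) + v * pow v k       ≈⟨ +-congʳ (*-congˡ (+-congˡ (binomialSum≈t*lucas+pow u v k))) ⟩
    u * (v * lucas u v k + (u * lucas u v k + pow v k)) + v * pow v k
      ≈⟨ solve 4 (λ u v h p → u :* (v :* h :+ (u :* h :+ p)) :+ v :* p := (u :+ v) :* (u :* h :+ p)) refl u v _ _ ⟩
    (u + v) * (u * lucas u v k + pow v k)                         ≈⟨ *-congˡ (binomialSum≈t*lucas+pow u v k) ⟨
    (u + v) * binomialSum u v k                                   ≈⟨ *-congˡ (binomial-theorem u v k) ⟩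
    pow (u + v) (suc k)                                           ∎

  lucas-recurrence : ∀ t b k → lucas t b (suc k) ≈ (t + b) * lucas t b k + pow b k
  lucas-recurrence t b k = trans (lucas-suc t b k) (trans (+-congˡ (binomialSum≈t*lucas+pow t b k))
    (solve 4 (λ b t h p → b :* h :+ (t :* h :+ p) := (t :+ b) :* h :+ p) refl b t _ _))

  lucas-recurrence₂ : ∀ t b k →
    lucas t b (suc (suc k)) ≈ ((t + b) + b) * lucas t b (suc k) - (t + b) * b * lucas t b k
  lucas-recurrence₂ t b k = begin
    lucas t b (suc (suc k))                         ≈⟨ lucas-recurrence t b (suc k) ⟩
    (t + b) * lucas t b (suc k) + b * pow b k       ≈⟨ +-congʳ (*-congˡ (lucas-recurrence t b k)) ⟩
    (t + b) * ((t + b) * lucas t b k + pow b k) + b * pow b k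
      ≈⟨ solve 4 (λ a b h p → a :* (a :* h :+ p) :+ b :* p := (a :+ b) :* (a :* h :+ p) :- a :* b :* h) refl (t + b) b _ _ ⟩
    ((t + b) + b) * ((t + b) * lucas t b k + pow b k) - (t + b) * b * lucas t b k
      ≈⟨ +-congʳ (*-congˡ (lucas-recurrence t b k)) ⟨
    ((t + b) + b) * lucas t b (suc k) - (t + b) * b * lucas t b k ∎

  binomial-derivative : ∀ u v n →
    sumBelow n (λ m → nat (n C m) * nat (n ∸ m) * pow u (n ∸ suc m) * pow v m) ≈ nat n * pow (u + v) (n ∸ 1)
  binomial-derivative u v zero    = sym (trans (*-congʳ nat-0) (zeroˡ _))
  binomial-derivative u v (suc n) = begin
    sumBelow (suc n) (λ m → nat (suc n C m) * nat (suc n ∸ m) * pow u (n ∸ m) * pow v m)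
      ≈⟨ sumBelow-cong (suc n) (λ m m≤n → trans (*-congʳ (*-congʳ (absorb (ℕ.≤-pred m≤n))))
                                               (trans (*-congʳ (*-assoc _ _ _)) (*-assoc _ _ _))) ⟩
    sumBelow (suc n) (λ m → nat (suc n) * (nat (n C m) * pow u (n ∸ m) * pow v m))
      ≈⟨ sumBelow-*ˡ (suc n) _ _ ⟩
    nat (suc n) * binomialSum u v n
      ≈⟨ *-congˡ (binomial-theorem u v n) ⟩
    nat (suc n) * pow (u + v) n ∎
    where
    absorb : ∀ {m} → m ≤ n → nat (suc n C m) * nat (suc n ∸ m) ≈ nat (suc n) * nat (n C m)
    absorb {m} m≤n = trans (sym (nat-* (suc n C m) (suc n ∸ m)))
      (trans (nat-≡ ([1+n]Ck*[1+n∸k]≡[1+n]*nCk {n} {m} m≤n)) (nat-* (suc n) (n C m)))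

  bernoulli-lucas-convolution : ∀ x t b n →
    sumBelow (suc n) (λ k → nat (n C k) * pow t (n ∸ k) * lucas t b k * bernoulli (n ∸ k) x)
      ≈ nat n * pow (t * x + b) (n ∸ 1)
  bernoulli-lucas-convolution x t b n = begin
    sumBelow (suc n) F
      ≈⟨ sumBelow-reverse (suc n) F ⟩
    sumBelow (suc n) (λ j → F (n ∸ j))
      ≈⟨ sumBelow-cong (suc n) (λ j j≤n → expand (ℕ.≤-pred j≤n)) ⟩
    sumBelow n (λ j → sumBelow (n ∸ j) (g j)) + sumBelow (n ∸ n) (g n)
      ≈⟨ trans (+-congˡ (sumBelow-≡ (g n) (ℕ.n∸n≡0 n))) (+-identityʳ _) ⟩
    sumBelow n (λ j → sumBelow (n ∸ j) (g j))
      ≈⟨ sumBelow-triangle-swap n g ⟩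
    sumBelow n (λ m → sumBelow (n ∸ m) (λ j → g j m))
      ≈⟨ sumBelow-cong n (λ m m<n → trans (sumBelow-cong (n ∸ m) (swap-binomials m<n)) (sumBelow-*ˡ (n ∸ m) _ _)) ⟩
    sumBelow n (λ m → nat (n C m) * Q m * sumBelow (n ∸ m) (λ j → nat ((n ∸ m) C j) * bernoulli j x))
      ≈⟨ sumBelow-cong n (λ m m<n → *-congˡ (bernoulli-row m<n)) ⟩
    sumBelow n (λ m → nat (n C m) * Q m * (nat (n ∸ m) * pow x (n ∸ suc m)))
      ≈⟨ sumBelow-cong n (λ m _ → collect m) ⟩
    sumBelow n (λ m → nat (n C m) * nat (n ∸ m) * pow (t * x) (n ∸ suc m) * pow b m)
      ≈⟨ binomial-derivative (t * x) b n ⟩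
    nat n * pow (t * x + b) (n ∸ 1) ∎
    where
    F : ℕ → Carrier
    F k = nat (n C k) * pow t (n ∸ k) * lucas t b k * bernoulli (n ∸ k) x
    Q : ℕ → Carrier
    Q m = pow t (n ∸ suc m) * pow b m
    g : ℕ → ℕ → Carrier
    g j m = nat (n C j) * nat ((n ∸ j) C m) * Q m * bernoulli j x

    expand : ∀ {j} → j ≤ n → F (n ∸ j) ≈ sumBelow (n ∸ j) (g j)
    expand {j} j≤n = begin
      F (n ∸ j)
        ≈⟨ *-cong (*-congʳ (*-cong (nat-≡ (≡.sym (nCk≡nC[n∸k] j≤n))) (pow-≡ t n∸[n∸j]≡j)))
                  (reflexive (≡.cong (λ i → bernoulli i x) n∸[n∸j]≡j)) ⟩
      nat (n C j) * pow t j * lucas t b (n ∸ j) * bernoulli j x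
        ≈⟨ trans (sumBelow-*ʳ (n ∸ j) _ _) (*-congʳ (sumBelow-*ˡ (n ∸ j) _ _)) ⟨
      sumBelow (n ∸ j) (λ m → nat (n C j) * pow t j * (nat ((n ∸ j) C m) * pow t (n ∸ j ∸ suc m) * pow b m) * bernoulli j x)
        ≈⟨ sumBelow-cong (n ∸ j) (λ m m<n∸j → trans
             (solve 6 (λ c p c' p' q β → c :* p :* (c' :* p' :* q) :* β := c :* c' :* (p :* p' :* q) :* β) refl _ _ _ _ _ _)
             (*-congʳ (*-congˡ (*-congʳ (trans (sym (pow-+ t j _)) (pow-≡ t (merge m<n∸j))))))) ⟩
      sumBelow (n ∸ j) (g j) ∎
      where
      n∸[n∸j]≡j : n ∸ (n ∸ j) ≡ j
      n∸[n∸j]≡j = ℕ.m∸[m∸n]≡n j≤n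
      merge : ∀ {m} → m < n ∸ j → j ℕ.+ (n ∸ j ∸ suc m) ≡ n ∸ suc m
      merge {m} m<n∸j = ≡.trans (≡.sym (ℕ.+-∸-assoc j m<n∸j)) (≡.cong (_∸ suc m) (ℕ.m+[n∸m]≡n j≤n))

    swap-binomials : ∀ {m} → m < n → ∀ j → j < n ∸ m → g j m ≈ nat (n C m) * Q m * (nat ((n ∸ m) C j) * bernoulli j x)
    swap-binomials {m} m<n j j<n∸m = trans
      (*-congʳ (*-congʳ (trans (sym (nat-* (n C j) ((n ∸ j) C m)))
        (trans (nat-≡ (nCj*[n∸j]Cm≡nCm*[n∸m]Cj {n} {j} {m} j+m≤n)) (nat-* (n C m) ((n ∸ m) C j))))))
      (solve 4 (λ c c' q β → c :* c' :* q :* β := c :* q :* (c' :* β)) refl _ _ _ _)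
      where
      j+m≤n : j ℕ.+ m ≤ n
      j+m≤n = ℕ.m≤o∸n⇒m+n≤o j (ℕ.<⇒≤ m<n) (ℕ.<⇒≤ j<n∸m)

    bernoulli-row : ∀ {m} → m < n →
      sumBelow (n ∸ m) (λ j → nat ((n ∸ m) C j) * bernoulli j x) ≈ nat (n ∸ m) * pow x (n ∸ suc m)
    bernoulli-row {m} m<n rewrite ℕ.+-∸-assoc 1 m<n = bernoulli-recurrence x (n ∸ suc m)

    collect : ∀ m → nat (n C m) * Q m * (nat (n ∸ m) * pow x (n ∸ suc m))
                    ≈ nat (n C m) * nat (n ∸ m) * pow (t * x) (n ∸ suc m) * pow b m
    collect m = trans
      (solve 5 (λ c p q d r → c :* (p :* q) :* (d :* r) := c :* d :* (p :* r) :* q) refl _ _ _ _ _)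
      (*-congʳ (*-congˡ (sym (pow-* t x (n ∸ suc m)))))

  balancing-recurrence₂ : ∀ x m →
    balancing (4 ℕ.+ m) x ≈ (nat 6 * x * (nat 6 * x) - nat 2) * balancing (2 ℕ.+ m) x - balancing m x
  balancing-recurrence₂ x m = solve 3 (λ y B₀ B₁ →
      con (+ 6 / 1) :* y :* (con (+ 6 / 1) :* y :* (con (+ 6 / 1) :* y :* B₁ :- B₀) :- B₁) :- (con (+ 6 / 1) :* y :* B₁ :- B₀)
      := (con (+ 6 / 1) :* y :* (con (+ 6 / 1) :* y) :- con (+ 2 / 1)) :* (con (+ 6 / 1) :* y :* B₁ :- B₀) :- B₀)
    refl x (balancing m x) (balancing (suc m) x)

  balancing-even-recurrence : ∀ x k → balancing (2 ℕ.* suc (suc k)) x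
    ≈ (nat 6 * x * (nat 6 * x) - nat 2) * balancing (2 ℕ.* suc k) x - balancing (2 ℕ.* k) x
  balancing-even-recurrence x k = trans (balancing-≡ 2k+4≡4+2k)
    (trans (balancing-recurrence₂ x (2 ℕ.* k)) (+-congʳ (*-congˡ (balancing-≡ (≡.sym 2k+2≡2+2k)))))
    where
    balancing-≡ : ∀ {m n} → m ≡ n → balancing m x ≈ balancing n x
    balancing-≡ e = reflexive (≡.cong (λ i → balancing i x) e)
    2k+2≡2+2k : 2 ℕ.* suc k ≡ 2 ℕ.+ 2 ℕ.* k
    2k+2≡2+2k = ℕ.*-suc 2 k
    2k+4≡4+2k : 2 ℕ.* suc (suc k) ≡ 4 ℕ.+ 2 ℕ.* k
    2k+4≡4+2k = ≡.trans (ℕ.*-suc 2 (suc k)) (≡.cong (2 ℕ.+_) 2k+2≡2+2k)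

  module CharacteristicRoots (x s : Carrier) where
    t b b′ : Carrier
    t  = nat 12 * x * s
    b  = nat 18 * x * x - 1# - nat 6 * x * s
    b′ = nat 18 * x * x - nat 1 - nat 6 * x * s

    b≈b′ : b ≈ b′
    b≈b′ = +-congʳ (+-congˡ (-‿cong (sym nat-1)))

    product-of-roots : s * s ≈ nat 9 * x * x - 1# → (t + b) * b ≈ 1#
    product-of-roots s²≈9x²-1 = begin
      (t + b) * b
        ≈⟨ *-cong (+-congˡ b≈b′) b≈b′ ⟩
      (t + b′) * b′
        ≈⟨ solve 2 (λ y z → (con (+ 12 / 1) :* y :* z :+ (con (+ 18 / 1) :* y :* y :- con 1ℚ :- con (+ 6 / 1) :* y :* z))
                               :* (con (+ 18 / 1) :* y :* y :- con 1ℚ :- con (+ 6 / 1) :* y :* z)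
                             := con 1ℚ :- con (+ 36 / 1) :* y :* y :* (z :* z :- (con (+ 9 / 1) :* y :* y :- con 1ℚ))) refl x s ⟩
      nat 1 - nat 36 * x * x * (s * s - (nat 9 * x * x - nat 1))
        ≈⟨ +-cong nat-1 (-‿cong (*-congˡ (trans (+-congʳ s²≈9x²-1) (trans (+-congˡ (-‿cong (+-congˡ (-‿cong nat-1)))) (-‿inverseʳ _))))) ⟩
      1# - nat 36 * x * x * 0#
        ≈⟨ trans (+-congˡ (trans (-‿cong (zeroʳ _)) -0#≈0#)) (+-identityʳ 1#) ⟩
      1# ∎

    sum-of-roots : (t + b) + b ≈ nat 6 * x * (nat 6 * x) - nat 2
    sum-of-roots = trans (+-cong (+-congˡ b≈b′) b≈b′)
      (solve 2 (λ y z → (con (+ 12 / 1) :* y :* z :+ (con (+ 18 / 1) :* y :* y :- con 1ℚ :- con (+ 6 / 1) :* y :* z))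
                          :+ (con (+ 18 / 1) :* y :* y :- con 1ℚ :- con (+ 6 / 1) :* y :* z)
                        := con (+ 6 / 1) :* y :* (con (+ 6 / 1) :* y) :- con (+ 2 / 1)) refl x s)

    t*x+b≈18x²-1+6x[2x-1]s : t * x + b ≈ nat 18 * x * x - 1# + nat 6 * x * (nat 2 * x - 1#) * s
    t*x+b≈18x²-1+6x[2x-1]s = begin
      t * x + b
        ≈⟨ +-congˡ b≈b′ ⟩
      t * x + b′
        ≈⟨ solve 2 (λ y z → con (+ 12 / 1) :* y :* z :* y :+ (con (+ 18 / 1) :* y :* y :- con 1ℚ :- con (+ 6 / 1) :* y :* z)
                         := con (+ 18 / 1) :* y :* y :- con 1ℚ :+ con (+ 6 / 1) :* y :* (con (+ 2 / 1) :* y :- con 1ℚ) :* z) refl x s ⟩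
      nat 18 * x * x - nat 1 + nat 6 * x * (nat 2 * x - nat 1) * s
        ≈⟨ +-cong (+-congˡ (-‿cong nat-1)) (*-congʳ (*-congˡ (+-congˡ (-‿cong nat-1)))) ⟩
      nat 18 * x * x - 1# + nat 6 * x * (nat 2 * x - 1#) * s ∎

    balancing-even≈6x*lucas : s * s ≈ nat 9 * x * x - 1# → ∀ k → balancing (2 ℕ.* k) x ≈ nat 6 * x * lucas t b k
    balancing-even≈6x*lucas s²≈9x²-1 zero = sym (zeroʳ _)
    balancing-even≈6x*lucas s²≈9x²-1 (suc zero) = begin
      nat 6 * x * 1# - 0#                ≈⟨ trans (+-congˡ -0#≈0#) (+-identityʳ _) ⟩
      nat 6 * x * 1#                     ≈⟨ *-congˡ (trans (sym nat-1) (sym (trans (+-identityˡ _) (trans (*-identityʳ _) (*-identityʳ _))))) ⟩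
      nat 6 * x * (0# + nat 1 * 1# * 1#) ∎
    balancing-even≈6x*lucas s²≈9x²-1 (suc (suc k)) = begin
      balancing (2 ℕ.* suc (suc k)) x
        ≈⟨ balancing-even-recurrence x k ⟩
      (nat 6 * x * (nat 6 * x) - nat 2) * balancing (2 ℕ.* suc k) x - balancing (2 ℕ.* k) x
        ≈⟨ +-cong (*-congʳ (sym sum-of-roots)) (-‿cong (sym (trans (*-congʳ (product-of-roots s²≈9x²-1)) (*-identityˡ _)))) ⟩
      ((t + b) + b) * balancing (2 ℕ.* suc k) x - (t + b) * b * balancing (2 ℕ.* k) x
        ≈⟨ +-cong (*-congˡ (balancing-even≈6x*lucas s²≈9x²-1 (suc k))) (-‿cong (*-congˡ (balancing-even≈6x*lucas s²≈9x²-1 k))) ⟩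
      ((t + b) + b) * (nat 6 * x * lucas t b (suc k)) - (t + b) * b * (nat 6 * x * lucas t b k)
        ≈⟨ solve 5 (λ a b c u₁ u₀ → a :* (c :* u₁) :- b :* (c :* u₀) := c :* (a :* u₁ :- b :* u₀)) refl _ _ _ _ _ ⟩
      nat 6 * x * (((t + b) + b) * lucas t b (suc k) - (t + b) * b * lucas t b k)
        ≈⟨ *-congˡ (lucas-recurrence₂ t b k) ⟨
      nat 6 * x * lucas t b (suc (suc k)) ∎

theorem6 : ∀ {c ℓ} (R : CommutativeRing c ℓ) (ι : ℚ → CommutativeRing.Carrier R) →
    IsRingHomomorphism (CommutativeRing.rawRing +-*-commutativeRing) (CommutativeRing.rawRing R) ι →
    let open CommutativeRing R in
    let open Over R ι in
    ∀ (x s : Carrier) → s * s ≈ nat 9 * x * x - 1# → ∀ (n : ℕ) →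
      sumTo n (λ k → nat (n C k) * pow (nat 12 * x * s) (n ∸ k) * balancing (2 ℕ.* k) x * bernoulli (n ∸ k) x)
        ≈ nat 6 * nat n * x * pow (nat 18 * x * x - 1# + nat 6 * x * (nat 2 * x - 1#) * s) (n ∸ 1)
theorem6 R ι hom x s s²≈9x²-1 n = begin
  sumTo n (λ k → nat (n C k) * pow t (n ∸ k) * balancing (2 ℕ.* k) x * bernoulli (n ∸ k) x)
    ≈⟨ sumTo≈sumBelow n _ ⟩
  sumBelow (suc n) (λ k → nat (n C k) * pow t (n ∸ k) * balancing (2 ℕ.* k) x * bernoulli (n ∸ k) x)
    ≈⟨ sumBelow-cong (suc n) (λ k _ → trans (*-congʳ (*-congˡ (balancing-even≈6x*lucas s²≈9x²-1 k)))
         (solve 5 (λ c p h u β → c :* p :* (h :* u) :* β := h :* (c :* p :* u :* β)) refl _ _ _ _ _)) ⟩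
  sumBelow (suc n) (λ k → nat 6 * x * (nat (n C k) * pow t (n ∸ k) * lucas t b k * bernoulli (n ∸ k) x))
    ≈⟨ sumBelow-*ˡ (suc n) _ _ ⟩
  nat 6 * x * sumBelow (suc n) (λ k → nat (n C k) * pow t (n ∸ k) * lucas t b k * bernoulli (n ∸ k) x)
    ≈⟨ *-congˡ (bernoulli-lucas-convolution x t b n) ⟩
  nat 6 * x * (nat n * pow (t * x + b) (n ∸ 1))
    ≈⟨ *-congˡ (*-congˡ (pow-cong (n ∸ 1) t*x+b≈18x²-1+6x[2x-1]s)) ⟩
  nat 6 * x * (nat n * pow (nat 18 * x * x - 1# + nat 6 * x * (nat 2 * x - 1#) * s) (n ∸ 1))
    ≈⟨ solve 3 (λ y m p → con (+ 6 / 1) :* y :* (m :* p) := con (+ 6 / 1) :* m :* y :* p) refl x (nat n) _ ⟩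
  nat 6 * nat n * x * pow (nat 18 * x * x - 1# + nat 6 * x * (nat 2 * x - 1#) * s) (n ∸ 1) ∎
  where
  open CommutativeRing R
  open Over R ι
  open ℚ-Algebra R ι hom
  open CharacteristicRoots x s
  open import Relation.Binary.Reasoning.Setoid setoid
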